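{- Let $n_1\le n_2$ be positive integers with $n_1$ even, and let $a=n_1/2$. Define the arrangement $A$ of $1,\dots,n_1n_2$ in an $n_1\times n_2$ matrix by placing in cell $(r,c)$ (row $r$, column $c$) the number $(c-1)a+r$ if $r\le a$, and the number $\frac{n_1n_2}{2}+(c-1)a+(r-a)$ if $r>a$ (i.e., the upper half-columns are filled consecutively column by column, left to right, then the lower half-columns likewise). Then $A$ has spread exactly $\frac{n_1(n_2+1)}{2}-1$, and hence (this being the lower bound for all arrangements when $n_1$ is even) $A$ is an arrangement of minimum spread.
   Context: An arrangement of $1,\dots,n_1n_2$ in an $n_1\times n_2$ matrix is a bijection between $\{1,\dots,n_1n_2\}$ and the cells $\{(r,c):1\le r\le n_1,1\le c\le n_2\}$. A line is a row or a column. The spread of an arrangement is the maximum, over all lines, of the difference between the largest and smallest number in the line. -}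

module Defs where

open import Data.Nat using (ℕ; zero; suc; _+_; _*_; _∸_; _<_; _<ᵇ_)
open import Data.Nat.Properties using (≤-totalOrder)
open import Data.Fin using (Fin; toℕ)
open import Data.List using (List; []; _∷_; map; _++_; allFin)
open import Data.Product using (_×_; _,_; Σ-syntax)
open import Data.Bool using (if_then_else_)
open import Function.Bundles using (_⤖_; Bijection)
open import Relation.Binary.PropositionalEquality using (_≡_)
import Data.List.Extrema as Ext
open Ext ≤-totalOrder using (min; max)

-- A matrix of natural numbers with n₁ rows and n₂ columns.
-- Rows/columns are indexed by Fin (0-based): Fin index i stands for row/column i+1.
Matrix : ℕ → ℕ → Set
Matrix n₁ n₂ = Fin n₁ → Fin n₂ → ℕ

IsArrangement : (n₁ n₂ : ℕ) → Matrix n₁ n₂ → Set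
IsArrangement n₁ n₂ M =
  Σ[ b ∈ ((Fin n₁ × Fin n₂) ⤖ Fin (n₁ * n₂)) ]
    (∀ r c → M r c ≡ suc (toℕ (Bijection.to b (r , c))))

-- largest / smallest element of a list (0 for the empty list; lines are nonempty here)
maxL : List ℕ → ℕ
maxL []       = 0
maxL (x ∷ xs) = max x xs

minL : List ℕ → ℕ
minL []       = 0
minL (x ∷ xs) = min x xs

lineDiff : List ℕ → ℕ
lineDiff xs = maxL xs ∸ minL xs

rowEntries : ∀ {n₁ n₂} → Matrix n₁ n₂ → Fin n₁ → List ℕ
rowEntries {n₂ = n₂} M r = map (λ c → M r c) (allFin n₂)

colEntries : ∀ {n₁ n₂} → Matrix n₁ n₂ → Fin n₂ → List ℕ
colEntries {n₁ = n₁} M c = map (λ r → M r c) (allFin n₁)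

spread : ∀ {n₁ n₂} → Matrix n₁ n₂ → ℕ
spread {n₁} {n₂} M =
  maxL (map (λ r → lineDiff (rowEntries M r)) (allFin n₁)
        ++ map (λ c → lineDiff (colEntries M c)) (allFin n₂))

-- The arrangement A (with a = n₁/2, so n₁n₂/2 = a * n₂).
-- 1-based cell (r,c) ↔ 0-based (r', c') = (r-1, c-1):
--   r ≤ a  (r' < a):  (c-1)a + r        = c' * a + (r' + 1)
--   r > a  (r' ≥ a):  n₁n₂/2 + (c-1)a + (r-a) = a * n₂ + c' * a + ((r' ∸ a) + 1)
matrixA : (n₁ a n₂ : ℕ) → Matrix n₁ n₂
matrixA n₁ a n₂ r c =
  if toℕ r <ᵇ a
  then toℕ c * a + suc (toℕ r)
  else a * n₂ + toℕ c * a + suc (toℕ r ∸ a)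

{-# OPTIONS --safe #-}
module Submission where

-- Write a row index as r = h·a + ρ with h < 2 and ρ < a.  Then A labels cell (r, c) by the
-- mixed-radix number with digits (h, c, ρ) and radices (2, n₂, a), a bijection onto
-- [0, n₁n₂).  Along a row only c varies, so a row spans a(n₂ − 1); along a column h and ρ
-- vary, so a column spans a·n₂ + a − 1, and the first column attains it.
--
-- For the lower bound, label the cells of an arrangement 0, …, N − 1 and suppose its
-- spread s is below a·n₂ + a − 1.  For a threshold x let p(x), q(x) count the rows and
-- columns meeting a label below x, and p̄ = n₁ − p, q̄ = n₂ − q.  The x labels below x lie
-- in p(x)·q(x) cells, and the N − x − s labels from x + s on share no line with a label
-- below x, so they lie in p̄(x)·q̄(x) cells.  With K = 1 + a(n₂ − 1), induction shows
-- p(x) ≤ a ≤ q̄(x) for all x ≤ K: at a first violation p̄ < a or q̄ < a, and either way the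
-- second count has too little room.  At x = K the first count gives K ≤ a(n₂ − a) < K.

open import Defs
open import Data.Bool.Base using (true; false; if_then_else_)
open import Data.Empty using (⊥; ⊥-elim)
open import Data.Fin.Base using (Fin; zero; suc; toℕ; fromℕ; fromℕ<; combine; remQuot; cast; _↑ˡ_; _↑ʳ_)
open import Data.Fin.Properties
  using (toℕ-↑ˡ; toℕ-↑ʳ; toℕ<n; toℕ≤pred[n]; toℕ-fromℕ; toℕ-fromℕ<; toℕ-cast; toℕ-combine; toℕ-injective;
         combine-remQuot; cast-involutive; *↔×; any?)
  renaming (_≟_ to _≟ᶠ_)
open import Data.List.Base using (_∷_; map; allFin)
open import Data.List.Membership.Propositional using (_∈_)
open import Data.List.Membership.Propositional.Properties using (∈-map⁺; ∈-allFin; ∈-++⁺ˡ; ∈-++⁺ʳ)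
open import Data.List.Relation.Unary.All as All using (All; []; _∷_)
import Data.List.Relation.Unary.All.Properties as All
open import Data.List.Relation.Unary.Any using (here; there)
open import Data.Nat.Base using (ℕ; zero; suc; _+_; _*_; _∸_; _≤_; _<_; _/_; _<ᵇ_; z≤n; s≤s)
open import Data.Nat.DivMod using (m*n/n≡m)
open import Data.Nat.Properties
open import Data.Nat.Tactic.RingSolver using (solve-∀)
open import Data.Product.Base using (_×_; _,_; proj₁; proj₂; ∃)
open import Data.Product.Function.NonDependent.Propositional using (_×-↔_)
open import Data.Vec.Functional using (Vector)
open import Function.Base using (_∘_)
open import Function.Bundles using (_↔_; _⤖_; mk↔ₛ′; Inverse; Bijection)
open import Function.Properties.Inverse using (↔-refl; ↔-sym; ↔-trans; ↔⇒⤖)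
open import Relation.Binary.Definitions using (tri<; tri≈; tri>)
open import Relation.Binary.PropositionalEquality
open import Relation.Nullary.Decidable using (Dec; yes; no; does; ¬?)
open import Relation.Nullary.Negation using (¬_)
open import Relation.Nullary.Reflects using (ofʸ; ofⁿ)
open import Data.List.Extrema ≤-totalOrder using (⊥≤max; xs≤max; max≤v⁺; min≤⊤; min≤xs; v≤min⁺)
open import Algebra.Properties.Semiring.Sum +-*-semiring
  using (sum; sum-syntax; sum-cong-≗; sum-replicate-zero; ∑-distrib-+; *-distribˡ-sum; *-distribʳ-sum)

private variable P Q R : Set

-- Spread

∈⇒≤maxL : ∀ {v xs} → v ∈ xs → v ≤ maxL xs
∈⇒≤maxL {xs = x ∷ xs} (here refl)  = ⊥≤max x xs
∈⇒≤maxL {xs = x ∷ xs} (there v∈xs) = All.lookup (xs≤max x xs) v∈xs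

∈⇒minL≤ : ∀ {v xs} → v ∈ xs → minL xs ≤ v
∈⇒minL≤ {xs = x ∷ xs} (here refl)  = min≤⊤ x xs
∈⇒minL≤ {xs = x ∷ xs} (there v∈xs) = All.lookup (min≤xs x xs) v∈xs

maxL≤ : ∀ {t xs} → All (_≤ t) xs → maxL xs ≤ t
maxL≤ []         = z≤n
maxL≤ (px ∷ pxs) = max≤v⁺ px pxs

∸≤lineDiff : ∀ {u v xs} → u ∈ xs → v ∈ xs → v ∸ u ≤ lineDiff xs
∸≤lineDiff u∈xs v∈xs = ∸-mono (∈⇒≤maxL v∈xs) (∈⇒minL≤ u∈xs)

lineDiff≤ : ∀ {lo d xs} → All (λ v → lo ≤ v × v ≤ lo + d) xs → lineDiff xs ≤ d
lineDiff≤ []                  = z≤n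
lineDiff≤ {lo} {d} (px ∷ pxs) =
  ≤-trans (∸-mono (maxL≤ (All.map proj₂ (px ∷ pxs))) (v≤min⁺ (proj₁ px) (All.map proj₁ pxs)))
          (≤-reflexive (m+n∸m≡n lo d))

∈-map-allFin : ∀ {n} (f : Fin n → ℕ) i → f i ∈ map f (allFin n)
∈-map-allFin f i = ∈-map⁺ f (∈-allFin i)

All-map-allFin : ∀ {n} {P : ℕ → Set} (f : Fin n → ℕ) → (∀ i → P (f i)) → All P (map f (allFin n))
All-map-allFin f Pf = All.map⁺ (All.tabulate⁺ Pf)

lineDiff-map≤ : ∀ {n d} lo (f g : Fin n → ℕ) → (∀ i → f i ≡ lo + g i) → (∀ i → g i ≤ d) →
                lineDiff (map f (allFin n)) ≤ d
lineDiff-map≤ {d = d} lo f g f≡lo+g g≤d = lineDiff≤ (All-map-allFin f λ i →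
  subst (λ v → lo ≤ v × v ≤ lo + d) (sym (f≡lo+g i)) (m≤m+n lo (g i) , +-monoʳ-≤ lo (g≤d i)))

module _ {n₁ n₂} (M : Matrix n₁ n₂) where

  row-∸≤spread : ∀ r c c′ → M r c ∸ M r c′ ≤ spread M
  row-∸≤spread r c c′ =
    ≤-trans (∸≤lineDiff (∈-map-allFin (M r) c′) (∈-map-allFin (M r) c))
            (∈⇒≤maxL (∈-++⁺ˡ (∈-map-allFin (lineDiff ∘ rowEntries M) r)))

  col-∸≤spread : ∀ c r r′ → M r c ∸ M r′ c ≤ spread M
  col-∸≤spread c r r′ =
    ≤-trans (∸≤lineDiff (∈-map-allFin (λ r → M r c) r′) (∈-map-allFin (λ r → M r c) r))
            (∈⇒≤maxL (∈-++⁺ʳ (map (lineDiff ∘ rowEntries M) (allFin n₁))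
                              (∈-map-allFin (lineDiff ∘ colEntries M) c)))

  spread≤ : ∀ {t} → (∀ r → lineDiff (rowEntries M r) ≤ t) → (∀ c → lineDiff (colEntries M c) ≤ t) →
            spread M ≤ t
  spread≤ rows cols = maxL≤ (All.++⁺ (All-map-allFin _ rows) (All-map-allFin _ cols))

-- The arrangement A

cast↔ : ∀ {m n} → m ≡ n → Fin m ↔ Fin n
cast↔ eq = mk↔ₛ′ (cast eq) (cast (sym eq)) (cast-involutive eq (sym eq)) (cast-involutive (sym eq) eq)

half : ∀ a → Fin (2 * a) → Fin 2
half a r = proj₁ (remQuot {2} a r)

offset : ∀ a → Fin (2 * a) → Fin a
offset a r = proj₂ (remQuot {2} a r)

module _ {a n₂ : ℕ} where

  matrixA-upper : ∀ {r} c → toℕ r < a → matrixA (2 * a) a n₂ r c ≡ toℕ c * a + suc (toℕ r)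
  matrixA-upper {r} c r<a with toℕ r <ᵇ a | <ᵇ-reflects-< (toℕ r) a
  ... | true  | _       = refl
  ... | false | ofⁿ r≮a = ⊥-elim (r≮a r<a)

  matrixA-lower : ∀ {r} c → a ≤ toℕ r → matrixA (2 * a) a n₂ r c ≡ a * n₂ + toℕ c * a + suc (toℕ r ∸ a)
  matrixA-lower {r} c a≤r with toℕ r <ᵇ a | <ᵇ-reflects-< (toℕ r) a
  ... | true  | ofʸ r<a = ⊥-elim (<⇒≱ r<a a≤r)
  ... | false | _       = refl

  matrixA-combine : ∀ (h : Fin 2) (ρ : Fin a) c →
                    matrixA (2 * a) a n₂ (combine h ρ) c ≡ suc (a * (n₂ * toℕ h + toℕ c) + toℕ ρ)
  matrixA-combine zero ρ c = begin
    matrixA (2 * a) a n₂ (ρ ↑ˡ _) c    ≡⟨ matrixA-upper c (subst (_< a) (sym (toℕ-↑ˡ ρ _)) (toℕ<n ρ)) ⟩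
    toℕ c * a + suc (toℕ (ρ ↑ˡ _))     ≡⟨ cong (λ i → toℕ c * a + suc i) (toℕ-↑ˡ ρ _) ⟩
    toℕ c * a + suc (toℕ ρ)            ≡⟨ digits a n₂ (toℕ c) (toℕ ρ) ⟩
    suc (a * (n₂ * 0 + toℕ c) + toℕ ρ) ∎
    where
    open ≡-Reasoning
    digits : ∀ a n₂ c ρ → c * a + suc ρ ≡ suc (a * (n₂ * 0 + c) + ρ)
    digits = solve-∀
  matrixA-combine (suc zero) ρ c = begin
    matrixA (2 * a) a n₂ (a ↑ʳ (ρ ↑ˡ _)) c              ≡⟨ matrixA-lower c (subst (a ≤_) (sym toℕ-r) (m≤m+n a _)) ⟩
    a * n₂ + toℕ c * a + suc (toℕ (a ↑ʳ (ρ ↑ˡ _)) ∸ a) ≡⟨ cong (λ i → a * n₂ + toℕ c * a + suc (i ∸ a)) toℕ-r ⟩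
    a * n₂ + toℕ c * a + suc (a + toℕ ρ ∸ a)           ≡⟨ cong (λ i → a * n₂ + toℕ c * a + suc i) (m+n∸m≡n a (toℕ ρ)) ⟩
    a * n₂ + toℕ c * a + suc (toℕ ρ)                   ≡⟨ digits a n₂ (toℕ c) (toℕ ρ) ⟩
    suc (a * (n₂ * 1 + toℕ c) + toℕ ρ)                 ∎
    where
    open ≡-Reasoning
    toℕ-r : toℕ (a ↑ʳ (ρ ↑ˡ (0 * a))) ≡ a + toℕ ρ
    toℕ-r = trans (toℕ-↑ʳ a _) (cong (a +_) (toℕ-↑ˡ ρ _))
    digits : ∀ a n₂ c ρ → a * n₂ + c * a + suc ρ ≡ suc (a * (n₂ * 1 + c) + ρ)
    digits = solve-∀

  matrixA-digits : ∀ r c → matrixA (2 * a) a n₂ r c ≡ suc (a * (n₂ * toℕ (half a r) + toℕ c) + toℕ (offset a r))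
  matrixA-digits r c = trans (cong (λ r → matrixA (2 * a) a n₂ r c) (sym (combine-remQuot {2} a r)))
                             (matrixA-combine (half a r) (offset a r) c)

  cellIndex : (Fin (2 * a) × Fin n₂) ↔ Fin (2 * a * n₂)
  cellIndex = ↔-trans (*↔× ×-↔ ↔-refl)
             (↔-trans swap-inner
             (↔-trans (↔-sym *↔× ×-↔ ↔-refl)
             (↔-trans (↔-sym *↔×)
                      (cast↔ (reorder a n₂)))))
    where
    swap-inner : ((Fin 2 × Fin a) × Fin n₂) ↔ ((Fin 2 × Fin n₂) × Fin a)
    swap-inner = mk↔ₛ′ (λ ((h , ρ) , c) → (h , c) , ρ) (λ ((h , c) , ρ) → (h , ρ) , c) (λ _ → refl) (λ _ → refl)
    reorder : ∀ a n₂ → 2 * n₂ * a ≡ 2 * a * n₂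
    reorder = solve-∀

  toℕ-cellIndex : ∀ r c → toℕ (Inverse.to cellIndex (r , c)) ≡ a * (n₂ * toℕ (half a r) + toℕ c) + toℕ (offset a r)
  toℕ-cellIndex r c = begin
    toℕ (Inverse.to cellIndex (r , c))                   ≡⟨ toℕ-cast _ _ ⟩
    toℕ (combine (combine (half a r) c) (offset a r))    ≡⟨ toℕ-combine (combine (half a r) c) (offset a r) ⟩
    a * toℕ (combine (half a r) c) + toℕ (offset a r)
      ≡⟨ cong (λ i → a * i + toℕ (offset a r)) (toℕ-combine (half a r) c) ⟩
    a * (n₂ * toℕ (half a r) + toℕ c) + toℕ (offset a r) ∎
    where open ≡-Reasoning

  matrixA-isArrangement : IsArrangement (2 * a) n₂ (matrixA (2 * a) a n₂)
  matrixA-isArrangement = ↔⇒⤖ cellIndex , λ r c → trans (matrixA-digits r c) (cong suc (sym (toℕ-cellIndex r c)))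

module _ {a′ n₂′ : ℕ} where
  private
    a n₂ : ℕ
    a  = suc a′
    n₂ = suc n₂′
    A = matrixA (2 * a) a n₂
    topRow bottomRow : Fin (2 * a)
    topRow    = combine {2} zero zero
    bottomRow = combine {2} (suc zero) (fromℕ a′)

  matrixA-rowDiff : ∀ r → lineDiff (rowEntries A r) ≤ a * n₂ + a′
  matrixA-rowDiff r = lineDiff-map≤ (suc (a * (n₂ * toℕ (half a r)) + toℕ (offset a r))) (A r) (λ c → a * toℕ c)
    (λ c → trans (matrixA-digits {a} {n₂} r c) (split a n₂ (toℕ (half a r)) (toℕ c) (toℕ (offset a r))))
    (λ c → ≤-trans (*-monoʳ-≤ a (<⇒≤ (toℕ<n c))) (m≤m+n (a * n₂) a′))
    where
    split : ∀ a n₂ h c ρ → suc (a * (n₂ * h + c) + ρ) ≡ suc (a * (n₂ * h) + ρ) + a * c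
    split = solve-∀

  matrixA-colDiff : ∀ c → lineDiff (colEntries A c) ≤ a * n₂ + a′
  matrixA-colDiff c = lineDiff-map≤ (suc (a * toℕ c)) (λ r → A r c)
    (λ r → a * (n₂ * toℕ (half a r)) + toℕ (offset a r))
    (λ r → trans (matrixA-digits {a} {n₂} r c) (split a n₂ (toℕ (half a r)) (toℕ c) (toℕ (offset a r))))
    (λ r → +-mono-≤ (*-monoʳ-≤ a (≤-trans (*-monoʳ-≤ n₂ (toℕ≤pred[n] (half a r))) (≤-reflexive (*-identityʳ n₂))))
                    (≤-pred (toℕ<n (offset a r))))
    where
    split : ∀ a n₂ h c ρ → suc (a * (n₂ * h + c) + ρ) ≡ suc (a * c) + (a * (n₂ * h) + ρ)
    split = solve-∀

  matrixA-cornerDiff : A bottomRow zero ∸ A topRow zero ≡ a * n₂ + a′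
  matrixA-cornerDiff = begin
    A bottomRow zero ∸ A topRow zero
      ≡⟨ cong₂ _∸_ (matrixA-combine {a} {n₂} (suc zero) (fromℕ a′) zero) (matrixA-combine {a} {n₂} zero zero zero) ⟩
    a * (n₂ * 1 + 0) + toℕ (fromℕ a′) ∸ (a * (n₂ * 0 + 0) + 0)
      ≡⟨ cong (λ i → a * (n₂ * 1 + 0) + i ∸ (a * (n₂ * 0 + 0) + 0)) (toℕ-fromℕ a′) ⟩
    a * (n₂ * 1 + 0) + a′ ∸ (a * (n₂ * 0 + 0) + 0)
      ≡⟨ cong₂ _∸_ (bottom a n₂ a′) (top a n₂) ⟩
    a * n₂ + a′ ∎
    where
    open ≡-Reasoning
    bottom : ∀ a n₂ a′ → a * (n₂ * 1 + 0) + a′ ≡ a * n₂ + a′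
    bottom = solve-∀
    top : ∀ a n₂ → a * (n₂ * 0 + 0) + 0 ≡ 0
    top = solve-∀

  spread-matrixA : spread A ≡ a * n₂ + a′
  spread-matrixA = ≤-antisym (spread≤ A matrixA-rowDiff matrixA-colDiff)
    (≤-trans (≤-reflexive (sym matrixA-cornerDiff)) (col-∸≤spread A zero bottomRow topRow))

spread-formula : ∀ a′ n₂ → (2 * suc a′ * (n₂ + 1)) / 2 ∸ 1 ≡ suc a′ * n₂ + a′
spread-formula a′ n₂ = begin
  2 * a * (n₂ + 1) / 2 ∸ 1  ≡⟨ cong (λ t → t / 2 ∸ 1) (e₁ a n₂) ⟩
  a * (n₂ + 1) * 2 / 2 ∸ 1  ≡⟨ cong (_∸ 1) (m*n/n≡m (a * (n₂ + 1)) 2) ⟩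
  a * (n₂ + 1) ∸ 1          ≡⟨ cong (_∸ 1) (e₂ a′ n₂) ⟩
  suc (a * n₂ + a′) ∸ 1     ∎
  where
  open ≡-Reasoning
  a = suc a′
  e₁ : ∀ a n₂ → 2 * a * (n₂ + 1) ≡ a * (n₂ + 1) * 2
  e₁ = solve-∀
  e₂ : ∀ a′ n₂ → suc a′ * (n₂ + 1) ≡ suc (suc a′ * n₂ + a′)
  e₂ = solve-∀

-- Counting labels below a threshold

-- Defined through does, so that 𝟙 (suc i ≟ᶠ suc j) reduces to 𝟙 (i ≟ᶠ j).
𝟙 : Dec P → ℕ
𝟙 P? = if does P? then 1 else 0

𝟙-yes : (P? : Dec P) → P → 𝟙 P? ≡ 1
𝟙-yes (yes _) _  = refl
𝟙-yes (no ¬p) p  = ⊥-elim (¬p p)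

𝟙-no : (P? : Dec P) → ¬ P → 𝟙 P? ≡ 0
𝟙-no (yes p) ¬p = ⊥-elim (¬p p)
𝟙-no (no _)  _  = refl

𝟙+𝟙¬ : (P? : Dec P) → 𝟙 P? + 𝟙 (¬? P?) ≡ 1
𝟙+𝟙¬ (yes _) = refl
𝟙+𝟙¬ (no _)  = refl

𝟙-mono : (P? : Dec P) (Q? : Dec Q) → (P → Q) → 𝟙 P? ≤ 𝟙 Q?
𝟙-mono (yes p) Q? P→Q = ≤-reflexive (sym (𝟙-yes Q? (P→Q p)))
𝟙-mono (no _)  _  _   = z≤n

𝟙≤𝟙*𝟙 : (P? : Dec P) (Q? : Dec Q) (R? : Dec R) → (P → Q) → (P → R) → 𝟙 P? ≤ 𝟙 Q? * 𝟙 R?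
𝟙≤𝟙*𝟙 (yes p) Q? R? P→Q P→R = ≤-reflexive (sym (cong₂ _*_ (𝟙-yes Q? (P→Q p)) (𝟙-yes R? (P→R p))))
𝟙≤𝟙*𝟙 (no _)  _  _  _   _   = z≤n

sum-mono-≤ : ∀ {n} {f g : Vector ℕ n} → (∀ i → f i ≤ g i) → sum f ≤ sum g
sum-mono-≤ {zero}  _   = z≤n
sum-mono-≤ {suc n} f≤g = +-mono-≤ (f≤g zero) (sum-mono-≤ (f≤g ∘ suc))

sum-const : ∀ n k → ∑[ i < n ] k ≡ n * k
sum-const zero    k = refl
sum-const (suc n) k = cong (k +_) (sum-const n k)

sum-𝟙≟ : ∀ {n} (j : Fin n) → ∑[ i < n ] 𝟙 (i ≟ᶠ j) ≡ 1
sum-𝟙≟ {suc n} zero    = cong suc (sum-replicate-zero n)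
sum-𝟙≟ {suc n} (suc j) = sum-𝟙≟ j

sum-𝟙+sum-𝟙¬ : ∀ {n} {P : Fin n → Set} (P? : ∀ i → Dec (P i)) →
               ∑[ i < n ] 𝟙 (P? i) + ∑[ i < n ] 𝟙 (¬? (P? i)) ≡ n
sum-𝟙+sum-𝟙¬ {n} P? = begin
  ∑[ i < n ] 𝟙 (P? i) + ∑[ i < n ] 𝟙 (¬? (P? i)) ≡⟨ ∑-distrib-+ (𝟙 ∘ P?) (𝟙 ∘ ¬? ∘ P?) ⟨
  ∑[ i < n ] (𝟙 (P? i) + 𝟙 (¬? (P? i)))         ≡⟨ sum-cong-≗ (𝟙+𝟙¬ ∘ P?) ⟩
  ∑[ i < n ] 1                                  ≡⟨ sum-const n 1 ⟩
  n * 1                                         ≡⟨ *-identityʳ n ⟩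
  n                                             ∎
  where open ≡-Reasoning

∑∑-product : ∀ {m n} (f : Vector ℕ m) (g : Vector ℕ n) → ∑[ i < m ] ∑[ j < n ] (f i * g j) ≡ sum f * sum g
∑∑-product {m} {n} f g = begin
  ∑[ i < m ] ∑[ j < n ] (f i * g j) ≡⟨ sum-cong-≗ (λ i → *-distribˡ-sum (f i) g) ⟨
  ∑[ i < m ] (f i * sum g)          ≡⟨ *-distribʳ-sum (sum g) f ⟨
  sum f * sum g                     ∎
  where open ≡-Reasoning

module Thresholds {n₁ n₂ : ℕ} (τ : Fin n₁ → Fin n₂ → ℕ) where

  rowMeets? : ∀ x r → Dec (∃ λ c → τ r c < x)
  rowMeets? x r = any? (λ c → τ r c <? x)

  colMeets? : ∀ x c → Dec (∃ λ r → τ r c < x)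
  colMeets? x c = any? (λ r → τ r c <? x)

  cellsAt cellsBelow cellsFrom rowsBelow rowsClear colsBelow colsClear : ℕ → ℕ
  cellsAt    y = ∑[ r < n₁ ] ∑[ c < n₂ ] 𝟙 (τ r c ≟ y)
  cellsBelow x = ∑[ r < n₁ ] ∑[ c < n₂ ] 𝟙 (τ r c <? x)
  cellsFrom  x = ∑[ r < n₁ ] ∑[ c < n₂ ] 𝟙 (¬? (τ r c <? x))
  rowsBelow  x = ∑[ r < n₁ ] 𝟙 (rowMeets? x r)
  rowsClear  x = ∑[ r < n₁ ] 𝟙 (¬? (rowMeets? x r))
  colsBelow  x = ∑[ c < n₂ ] 𝟙 (colMeets? x c)
  colsClear  x = ∑[ c < n₂ ] 𝟙 (¬? (colMeets? x c))

  rowsBelow+rowsClear : ∀ x → rowsBelow x + rowsClear x ≡ n₁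
  rowsBelow+rowsClear x = sum-𝟙+sum-𝟙¬ (rowMeets? x)

  colsBelow+colsClear : ∀ x → colsBelow x + colsClear x ≡ n₂
  colsBelow+colsClear x = sum-𝟙+sum-𝟙¬ (colMeets? x)

  cellsBelow+cellsFrom : ∀ x → cellsBelow x + cellsFrom x ≡ n₁ * n₂
  cellsBelow+cellsFrom x = begin
    cellsBelow x + cellsFrom x
      ≡⟨ ∑-distrib-+ (λ r → ∑[ c < n₂ ] 𝟙 (τ r c <? x)) (λ r → ∑[ c < n₂ ] 𝟙 (¬? (τ r c <? x))) ⟨
    ∑[ r < n₁ ] (∑[ c < n₂ ] 𝟙 (τ r c <? x) + ∑[ c < n₂ ] 𝟙 (¬? (τ r c <? x)))
      ≡⟨ sum-cong-≗ (λ r → sum-𝟙+sum-𝟙¬ (λ c → τ r c <? x)) ⟩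
    ∑[ r < n₁ ] n₂
      ≡⟨ sum-const n₁ n₂ ⟩
    n₁ * n₂ ∎
    where open ≡-Reasoning

  rowsBelow-zero : rowsBelow 0 ≡ 0
  rowsBelow-zero = trans (sum-cong-≗ λ r → 𝟙-no (rowMeets? 0 r) λ ()) (sum-replicate-zero n₁)

  colsClear-zero : colsClear 0 ≡ n₂
  colsClear-zero = trans (sum-cong-≗ λ c → 𝟙-yes (¬? (colMeets? 0 c)) λ ()) (trans (sum-const n₂ 1) (*-identityʳ n₂))

  rowsBelow-mono : ∀ x → rowsBelow x ≤ rowsBelow (suc x)
  rowsBelow-mono x = sum-mono-≤ λ r →
    𝟙-mono (rowMeets? x r) (rowMeets? (suc x) r) λ (c , τ<x) → c , m<n⇒m<1+n τ<x

  colsClear-antitone : ∀ x → colsClear (suc x) ≤ colsClear x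
  colsClear-antitone x = sum-mono-≤ λ c →
    𝟙-mono (¬? (colMeets? (suc x) c)) (¬? (colMeets? x c)) λ clear (r , τ<x) → clear (r , m<n⇒m<1+n τ<x)

  cellsBelow≤rowsBelow*colsBelow : ∀ x → cellsBelow x ≤ rowsBelow x * colsBelow x
  cellsBelow≤rowsBelow*colsBelow x = begin
    cellsBelow x
      ≤⟨ sum-mono-≤ (λ r → sum-mono-≤ λ c → 𝟙≤𝟙*𝟙 (τ r c <? x) (rowMeets? x r) (colMeets? x c) (c ,_) (r ,_)) ⟩
    ∑[ r < n₁ ] ∑[ c < n₂ ] (𝟙 (rowMeets? x r) * 𝟙 (colMeets? x c))
      ≡⟨ ∑∑-product (𝟙 ∘ rowMeets? x) (𝟙 ∘ colMeets? x) ⟩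
    rowsBelow x * colsBelow x ∎
    where open ≤-Reasoning

  module _ {s} (row-width : ∀ r c c′ → τ r c ∸ τ r c′ ≤ s) (col-width : ∀ c r r′ → τ r c ∸ τ r′ c ≤ s) where

    cellsFrom≤rowsClear*colsClear : ∀ x → cellsFrom (x + s) ≤ rowsClear x * colsClear x
    cellsFrom≤rowsClear*colsClear x = begin
      cellsFrom (x + s)
        ≤⟨ sum-mono-≤ (λ r → sum-mono-≤ λ c →
             𝟙≤𝟙*𝟙 (¬? (τ r c <? x + s)) (¬? (rowMeets? x r)) (¬? (colMeets? x c))
                   (λ far (c′ , τ<x) → far (near-below (row-width r c c′) τ<x))
                   (λ far (r′ , τ<x) → far (near-below (col-width c r r′) τ<x))) ⟩
      ∑[ r < n₁ ] ∑[ c < n₂ ] (𝟙 (¬? (rowMeets? x r)) * 𝟙 (¬? (colMeets? x c)))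
        ≡⟨ ∑∑-product (𝟙 ∘ ¬? ∘ rowMeets? x) (𝟙 ∘ ¬? ∘ colMeets? x) ⟩
      rowsClear x * colsClear x ∎
      where
      open ≤-Reasoning
      near-below : ∀ {u v} → v ∸ u ≤ s → u < x → v < x + s
      near-below {u} {v} v∸u≤s u<x = ≤-<-trans (m≤n+m∸n v u) (+-mono-<-≤ u<x v∸u≤s)

  cellsBelow-suc : ∀ x → cellsBelow (suc x) ≡ cellsBelow x + cellsAt x
  cellsBelow-suc x = begin
    cellsBelow (suc x)
      ≡⟨ sum-cong-≗ (λ r → sum-cong-≗ λ c → 𝟙-<-suc (τ r c)) ⟩
    ∑[ r < n₁ ] ∑[ c < n₂ ] (𝟙 (τ r c <? x) + 𝟙 (τ r c ≟ x))
      ≡⟨ sum-cong-≗ (λ r → ∑-distrib-+ (λ c → 𝟙 (τ r c <? x)) (λ c → 𝟙 (τ r c ≟ x))) ⟩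
    ∑[ r < n₁ ] (∑[ c < n₂ ] 𝟙 (τ r c <? x) + ∑[ c < n₂ ] 𝟙 (τ r c ≟ x))
      ≡⟨ ∑-distrib-+ (λ r → ∑[ c < n₂ ] 𝟙 (τ r c <? x)) (λ r → ∑[ c < n₂ ] 𝟙 (τ r c ≟ x)) ⟩
    cellsBelow x + cellsAt x ∎
    where
    open ≡-Reasoning
    𝟙-<-suc : ∀ t → 𝟙 (t <? suc x) ≡ 𝟙 (t <? x) + 𝟙 (t ≟ x)
    𝟙-<-suc t with <-cmp t x
    ... | tri< t<x t≢x _   = trans (𝟙-yes (t <? suc x) (m<n⇒m<1+n t<x))
                                   (sym (cong₂ _+_ (𝟙-yes (t <? x) t<x) (𝟙-no (t ≟ x) t≢x)))
    ... | tri≈ t≮x t≡x _   = trans (𝟙-yes (t <? suc x) (s≤s (≤-reflexive t≡x)))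
                                   (sym (cong₂ _+_ (𝟙-no (t <? x) t≮x) (𝟙-yes (t ≟ x) t≡x)))
    ... | tri> t≮x t≢x x<t = trans (𝟙-no (t <? suc x) (<⇒≱ x<t ∘ ≤-pred))
                                   (sym (cong₂ _+_ (𝟙-no (t <? x) t≮x) (𝟙-no (t ≟ x) t≢x)))

  cellsBelow≡ : (∀ y → y < n₁ * n₂ → cellsAt y ≡ 1) → ∀ x → x ≤ n₁ * n₂ → cellsBelow x ≡ x
  cellsBelow≡ unique zero    _   = n≤0⇒n≡0 (≤-trans (cellsBelow≤rowsBelow*colsBelow 0)
                                                    (≤-reflexive (cong (_* colsBelow 0) rowsBelow-zero)))
  cellsBelow≡ unique (suc x) x<N = begin
    cellsBelow (suc x)       ≡⟨ cellsBelow-suc x ⟩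
    cellsBelow x + cellsAt x ≡⟨ cong₂ _+_ (cellsBelow≡ unique x (<⇒≤ x<N)) (unique x x<N) ⟩
    x + 1                    ≡⟨ +-comm x 1 ⟩
    suc x                    ∎
    where open ≡-Reasoning

labelling : ∀ {n₁ n₂} → (Fin n₁ × Fin n₂) ⤖ Fin (n₁ * n₂) → Fin n₁ → Fin n₂ → ℕ
labelling b r c = toℕ (Bijection.to b (r , c))

cellsAt-labelling : ∀ {n₁ n₂} (b : (Fin n₁ × Fin n₂) ⤖ Fin (n₁ * n₂)) →
                    ∀ y → y < n₁ * n₂ → Thresholds.cellsAt (labelling b) y ≡ 1
cellsAt-labelling {n₁} {n₂} b y y<N = begin
  ∑[ r < n₁ ] ∑[ c < n₂ ] 𝟙 (τ r c ≟ y)                ≡⟨ sum-cong-≗ (λ r → sum-cong-≗ (δ r)) ⟩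
  ∑[ r < n₁ ] ∑[ c < n₂ ] (𝟙 (r ≟ᶠ r₀) * 𝟙 (c ≟ᶠ c₀)) ≡⟨ ∑∑-product (λ r → 𝟙 (r ≟ᶠ r₀)) (λ c → 𝟙 (c ≟ᶠ c₀)) ⟩
  ∑[ r < n₁ ] 𝟙 (r ≟ᶠ r₀) * ∑[ c < n₂ ] 𝟙 (c ≟ᶠ c₀)   ≡⟨ cong₂ _*_ (sum-𝟙≟ r₀) (sum-𝟙≟ c₀) ⟩
  1                                                    ∎
  where
  open ≡-Reasoning
  τ = labelling b
  preimage = Bijection.strictlySurjective b (fromℕ< y<N)
  r₀ = proj₁ (proj₁ preimage)
  c₀ = proj₂ (proj₁ preimage)
  τ₀≡y : τ r₀ c₀ ≡ y
  τ₀≡y = trans (cong toℕ (proj₂ preimage)) (toℕ-fromℕ< y<N)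
  τ≡y⇒≡ : ∀ {r c} → τ r c ≡ y → (r , c) ≡ (r₀ , c₀)
  τ≡y⇒≡ τ≡y = Bijection.injective b (toℕ-injective (trans τ≡y (sym τ₀≡y)))
  δ : ∀ r c → 𝟙 (τ r c ≟ y) ≡ 𝟙 (r ≟ᶠ r₀) * 𝟙 (c ≟ᶠ c₀)
  δ r c with r ≟ᶠ r₀ | c ≟ᶠ c₀
  ... | yes refl | yes refl = 𝟙-yes (τ r₀ c₀ ≟ y) τ₀≡y
  ... | yes _    | no c≢c₀  = 𝟙-no (τ r c ≟ y) (c≢c₀ ∘ cong proj₂ ∘ τ≡y⇒≡)
  ... | no r≢r₀  | _        = 𝟙-no (τ r c ≟ y) (r≢r₀ ∘ cong proj₁ ∘ τ≡y⇒≡)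

-- The lower bound

-- Each of the three bounds below contradicts the choice K + a = a·n₂ + 1.
overfull-rows-bound : ∀ {a n₂ K x q q̄ q̄′ p′ p̄′} → x ≤ a * q → q + q̄ ≡ n₂ → a ≤ q̄ → q̄′ ≤ q̄ →
                      a < p′ → p′ + p̄′ ≡ 2 * a → K ≤ x + p̄′ * q̄′ → K + a ≤ a * n₂
overfull-rows-bound {a} {n₂} {K} {x} {q} {q̄} {q̄′} {p′} {p̄′} x≤aq q+q̄ a≤q̄ q̄′≤q̄ a<p′ p′+p̄′ K≤ = begin
  K + a               ≤⟨ +-mono-≤ K≤ a≤q̄ ⟩
  x + p̄′ * q̄′ + q̄    ≤⟨ +-monoˡ-≤ q̄ (+-mono-≤ x≤aq (*-monoʳ-≤ p̄′ q̄′≤q̄)) ⟩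
  a * q + p̄′ * q̄ + q̄ ≡⟨ trans (+-assoc (a * q) _ q̄) (cong (a * q +_) (+-comm (p̄′ * q̄) q̄)) ⟩
  a * q + suc p̄′ * q̄ ≤⟨ +-monoʳ-≤ (a * q) (*-monoˡ-≤ q̄ p̄′<a) ⟩
  a * q + a * q̄      ≡⟨ *-distribˡ-+ a q q̄ ⟨
  a * (q + q̄)        ≡⟨ cong (a *_) q+q̄ ⟩
  a * n₂             ∎
  where
  open ≤-Reasoning
  p̄′<a : p̄′ < a
  p̄′<a = +-cancelˡ-< a p̄′ a (begin-strict
    a + p̄′  <⟨ +-monoˡ-< p̄′ a<p′ ⟩
    p′ + p̄′ ≡⟨ p′+p̄′ ⟩
    2 * a   ≡⟨ cong (a +_) (+-identityʳ a) ⟩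
    a + a   ∎)

p*q+p̄*a≤a*n : ∀ {a n p p̄ q} → p ≤ a → p + p̄ ≡ 2 * a → q + a ≤ n → 2 * a ≤ n → p * q + p̄ * a ≤ a * n
p*q+p̄*a≤a*n {a} {n} {p} {p̄} {q} p≤a p+p̄ q+a≤n 2a≤n with m≤n⇒∃[o]m+o≡n p≤a
... | g , refl = begin
  p * q + p̄ * (p + g)                   ≡⟨ cong (λ t → p * q + t * (p + g)) p̄≡p+g+g ⟩
  p * q + (p + g + g) * (p + g)         ≡⟨ regroup p g q ⟩
  p * (q + (p + g)) + g * (2 * (p + g)) ≤⟨ +-mono-≤ (*-monoʳ-≤ p q+a≤n) (*-monoʳ-≤ g 2a≤n) ⟩
  p * n + g * n                         ≡⟨ *-distribʳ-+ n p g ⟨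
  (p + g) * n                           ∎
  where
  open ≤-Reasoning
  regroup : ∀ p g q → p * q + (p + g + g) * (p + g) ≡ p * (q + (p + g)) + g * (2 * (p + g))
  regroup = solve-∀
  double : ∀ p g → 2 * (p + g) ≡ p + (p + g + g)
  double = solve-∀
  p̄≡p+g+g : p̄ ≡ p + g + g
  p̄≡p+g+g = +-cancelˡ-≡ p p̄ (p + g + g) (trans p+p̄ (double p g))

overfull-columns-bound : ∀ {a n₂ K x q q̄ p′ p̄′ q̄′} → 2 * a ≤ n₂ → x ≤ p′ * q → q + q̄ ≡ n₂ → a ≤ q̄ →
                         p′ ≤ a → p′ + p̄′ ≡ 2 * a → q̄′ < a → K ≤ x + p̄′ * q̄′ → K + a ≤ a * n₂
overfull-columns-bound {a} {n₂} {K} {x} {q} {q̄} {p′} {p̄′} {q̄′} 2a≤n₂ x≤p′q q+q̄ a≤q̄ p′≤a p′+p̄′ q̄′<a K≤ = begin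
  K + a             ≤⟨ +-mono-≤ K≤ a≤p̄′ ⟩
  x + p̄′ * q̄′ + p̄′ ≡⟨ trans (+-assoc x _ p̄′) (cong (x +_) (trans (+-comm (p̄′ * q̄′) p̄′) (sym (*-suc p̄′ q̄′)))) ⟩
  x + p̄′ * suc q̄′  ≤⟨ +-mono-≤ x≤p′q (*-monoʳ-≤ p̄′ q̄′<a) ⟩
  p′ * q + p̄′ * a  ≤⟨ p*q+p̄*a≤a*n p′≤a p′+p̄′ q+a≤n₂ 2a≤n₂ ⟩
  a * n₂           ∎
  where
  open ≤-Reasoning
  a≤p̄′ : a ≤ p̄′
  a≤p̄′ = +-cancelˡ-≤ a a p̄′ (begin
    a + a   ≡⟨ cong (a +_) (+-identityʳ a) ⟨
    2 * a   ≡⟨ p′+p̄′ ⟨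
    p′ + p̄′ ≤⟨ +-monoˡ-≤ p̄′ p′≤a ⟩
    a + p̄′  ∎)
  q+a≤n₂ : q + a ≤ n₂
  q+a≤n₂ = ≤-trans (+-monoʳ-≤ q a≤q̄) (≤-reflexive q+q̄)

confined-bound : ∀ {a n₂ K q q̄} → 1 ≤ a → K ≤ a * q → q + q̄ ≡ n₂ → a ≤ q̄ → K + a ≤ a * n₂
confined-bound {a} {n₂} {K} {q} {q̄} 1≤a K≤aq q+q̄ a≤q̄ = begin
  K + a         ≡⟨ cong (K +_) (*-identityʳ a) ⟨
  K + a * 1     ≤⟨ +-mono-≤ K≤aq (*-monoʳ-≤ a (≤-trans 1≤a a≤q̄)) ⟩
  a * q + a * q̄ ≡⟨ *-distribˡ-+ a q q̄ ⟨
  a * (q + q̄)   ≡⟨ cong (a *_) q+q̄ ⟩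
  a * n₂        ∎
  where open ≤-Reasoning

module LowerBound {a′ n₂′ : ℕ} (2a≤n₂ : 2 * suc a′ ≤ suc n₂′)
                  {M : Matrix (2 * suc a′) (suc n₂′)} (arrangement : IsArrangement (2 * suc a′) (suc n₂′) M)
                  (spread<a*n₂+a′ : spread M < suc a′ * suc n₂′ + a′) where

  τ : Fin (2 * suc a′) → Fin (suc n₂′) → ℕ
  τ = labelling (proj₁ arrangement)

  a n₂ N K s : ℕ
  a  = suc a′
  n₂ = suc n₂′
  N  = 2 * a * n₂
  K  = suc (a * n₂′)
  s  = spread M

  open Thresholds τ

  a*n₂<K+a : a * n₂ < K + a
  a*n₂<K+a = ≤-reflexive (e a′ n₂′)
    where
    e : ∀ a′ n₂′ → suc (suc a′ * suc n₂′) ≡ suc (suc a′ * n₂′) + suc a′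
    e = solve-∀

  K+s<N : suc K + s ≤ N
  K+s<N = begin
    suc K + s         ≡⟨ +-suc K s ⟨
    K + suc s         ≤⟨ +-monoʳ-≤ K spread<a*n₂+a′ ⟩
    K + (a * n₂ + a′) ≡⟨ e a′ n₂′ ⟩
    N                 ∎
    where
    open ≤-Reasoning
    e : ∀ a′ n₂′ → suc (suc a′ * n₂′) + (suc a′ * suc n₂′ + a′) ≡ 2 * suc a′ * suc n₂′
    e = solve-∀

  -- Labels are entries minus one, and suc m ∸ suc n reduces to m ∸ n.
  row-width : ∀ r c c′ → τ r c ∸ τ r c′ ≤ s
  row-width r c c′ = subst (_≤ s) (cong₂ _∸_ (proj₂ arrangement r c) (proj₂ arrangement r c′)) (row-∸≤spread M r c c′)

  col-width : ∀ c r r′ → τ r c ∸ τ r′ c ≤ s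
  col-width c r r′ = subst (_≤ s) (cong₂ _∸_ (proj₂ arrangement r c) (proj₂ arrangement r′ c)) (col-∸≤spread M c r r′)

  cellsBelow-labelling : ∀ {x} → x ≤ N → cellsBelow x ≡ x
  cellsBelow-labelling = cellsBelow≡ (cellsAt-labelling (proj₁ arrangement)) _

  below : ∀ {x} → x ≤ K → x ≤ rowsBelow x * colsBelow x
  below {x} x≤K = subst (_≤ rowsBelow x * colsBelow x) (cellsBelow-labelling x≤N) (cellsBelow≤rowsBelow*colsBelow x)
    where x≤N = ≤-trans x≤K (≤-trans (n≤1+n K) (≤-trans (m≤m+n (suc K) s) K+s<N))

  above : ∀ {x} → x ≤ K → K < x + rowsClear x * colsClear x
  above {x} x≤K = +-cancelʳ-≤ s (suc K) (x + rowsClear x * colsClear x) (begin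
    suc K + s                              ≤⟨ K+s<N ⟩
    N                                      ≡⟨ cellsBelow+cellsFrom (x + s) ⟨
    cellsBelow (x + s) + cellsFrom (x + s) ≡⟨ cong (_+ cellsFrom (x + s)) (cellsBelow-labelling x+s≤N) ⟩
    x + s + cellsFrom (x + s)              ≤⟨ +-monoʳ-≤ (x + s) (cellsFrom≤rowsClear*colsClear row-width col-width x) ⟩
    x + s + rowsClear x * colsClear x      ≡⟨ swap x s (rowsClear x * colsClear x) ⟩
    x + rowsClear x * colsClear x + s      ∎)
    where
    open ≤-Reasoning
    x+s≤N = ≤-trans (+-monoˡ-≤ s (≤-trans x≤K (n≤1+n K))) K+s<N
    swap : ∀ x s y → x + s + y ≡ x + y + s
    swap = solve-∀

  Confined : ℕ → Set
  Confined x = rowsBelow x ≤ a × a ≤ colsClear x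

  confined-zero : Confined 0
  confined-zero = subst (_≤ a) (sym rowsBelow-zero) z≤n
                , subst (a ≤_) (sym colsClear-zero) (≤-trans (m≤m+n a (a + 0)) 2a≤n₂)

  confined-suc : ∀ {x} → suc x ≤ K → Confined x → Confined (suc x)
  confined-suc {x} x<K (p≤a , a≤q̄) with rowsBelow (suc x) ≤? a | a ≤? colsClear (suc x)
  ... | yes p′≤a | yes a≤q̄′ = p′≤a , a≤q̄′
  ... | no p′≰a  | _         = ⊥-elim (<⇒≱ a*n₂<K+a
        (overfull-rows-bound (≤-trans (below (<⇒≤ x<K)) (*-monoˡ-≤ (colsBelow x) p≤a))
                             (colsBelow+colsClear x) a≤q̄ (colsClear-antitone x)
                             (≰⇒> p′≰a) (rowsBelow+rowsClear (suc x)) (≤-pred (above x<K))))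
  ... | yes p′≤a | no a≰q̄′  = ⊥-elim (<⇒≱ a*n₂<K+a
        (overfull-columns-bound 2a≤n₂ (≤-trans (below (<⇒≤ x<K)) (*-monoˡ-≤ (colsBelow x) (rowsBelow-mono x)))
                                (colsBelow+colsClear x) a≤q̄
                                p′≤a (rowsBelow+rowsClear (suc x)) (≰⇒> a≰q̄′) (≤-pred (above x<K))))

  confined : ∀ {x} → x ≤ K → Confined x
  confined {zero}  _   = confined-zero
  confined {suc x} x<K = confined-suc x<K (confined (<⇒≤ x<K))

  absurd : ⊥
  absurd = <⇒≱ a*n₂<K+a (confined-bound (s≤s z≤n) (≤-trans (below ≤-refl) (*-monoˡ-≤ (colsBelow K) p≤a))
                                        (colsBelow+colsClear K) a≤q̄)
    where
    p≤a = proj₁ (confined ≤-refl)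
    a≤q̄ = proj₂ (confined ≤-refl)

spread-lower-bound : ∀ {a′ n₂′} → 2 * suc a′ ≤ suc n₂′ → (M : Matrix (2 * suc a′) (suc n₂′)) →
                     IsArrangement (2 * suc a′) (suc n₂′) M → suc a′ * suc n₂′ + a′ ≤ spread M
spread-lower-bound 2a≤n₂ M arrangement = ≮⇒≥ (LowerBound.absurd 2a≤n₂ arrangement)

mainTheorem3 : (n₁ n₂ a : ℕ) → 1 ≤ n₁ → n₁ ≤ n₂ → n₁ ≡ 2 * a →
    IsArrangement n₁ n₂ (matrixA n₁ a n₂)
    × spread (matrixA n₁ a n₂) ≡ (n₁ * (n₂ + 1)) / 2 ∸ 1
    × (∀ (M : Matrix n₁ n₂) → IsArrangement n₁ n₂ M → spread (matrixA n₁ a n₂) ≤ spread M)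
mainTheorem3 _ _         zero     ()  _     refl
mainTheorem3 _ zero      (suc a′) _   ()    refl
mainTheorem3 _ (suc n₂′) (suc a′) _   2a≤n₂ refl =
    matrixA-isArrangement {suc a′}
  , trans (spread-matrixA {a′} {n₂′}) (sym (spread-formula a′ (suc n₂′)))
  , λ M arrangement → ≤-trans (≤-reflexive (spread-matrixA {a′} {n₂′})) (spread-lower-bound 2a≤n₂ M arrangement)
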